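{- Let $p$ be a prime and let $a\in\mathbb{Z}$. Then $v_p\left(a^p-a\right)=v_p\left(a^{p^m}-a\right)$ for every integer $m>0$.
   Context: $v_p$ denotes the $p$-adic valuation on $\mathbb{Z}$ (with $v_p(0)=\infty$). -}

module Defs where

open import Data.Nat as ℕ using (ℕ; suc)
open import Data.Integer using (ℤ; +_; 0ℤ)
open import Data.Integer.Divisibility using (_∣_)
open import Relation.Binary.PropositionalEquality using (_≡_)
open import Relation.Nullary using (¬_)

data ℕ∞ : Set where
  fin : ℕ → ℕ∞
  ∞   : ℕ∞

data Val (p : ℕ) (x : ℤ) : ℕ∞ → Set where
  val-∞   : x ≡ 0ℤ → Val p x ∞
  val-fin : (k : ℕ) → ¬ (x ≡ 0ℤ) → (+ (p ℕ.^ k)) ∣ x → ¬ ((+ (p ℕ.^ suc k)) ∣ x) → Val p x (fin k)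

-- Fermat's little theorem gives p ∣ a^p - a. Writing x^n - y^n = (x - y) G with
-- G = Σ x^i y^(n-1-i) ≡ n y^(n-1) mod (x - y), one gets d n ∣ x^n - y^n whenever
-- n ∣ x - y and d ∣ x - y; hence p^k ∣ a^p - a implies p^(k+1) ∣ (a^p)^p - a^p,
-- and then p^(k+1) ∣ a^(p^m) - a^p, because d ∣ b^p - b implies d ∣ b^(p^j) - b.
-- So a^(p^m) - a differs from a^p - a by a multiple of a strictly higher power of
-- p than any power dividing a^p - a: by induction on k both numbers are divisible
-- by exactly the same powers of p, and therefore have the same valuation.
module Submission where

open import Defs
open import Data.Nat using (ℕ; _<_)
open import Data.Nat.Primality using (Prime)
open import Data.Integer using (ℤ; _-_; _^_)
open import Function.Bundles using (_⇔_)

open import Data.Nat.Base as ℕ using (zero; suc; _!; _∸_; _≤_; s≤s; z≤n; NonZero)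
open import Data.Nat.Properties as ℕ using (<⇒≤; <⇒≱; <-trans; n<1+n; ∸-monoʳ-<; m<m*n; m^n≢0; _!*_!≢0)
import Data.Nat.Divisibility as ℕ
open import Data.Nat.DivMod using (_/_; m*[n/m]≡n)
open import Data.Nat.Primality using (euclidsLemma; prime⇒nonZero; prime⇒nonTrivial)
open import Data.Nat.Combinatorics using (_C_; nCn≡1; nCk≡n!/k![n-k]!; k![n∸k]!∣n!)
open import Data.Fin.Base using (Fin; zero; suc; toℕ; inject₁; fromℕ)
open import Data.Fin.Properties using (toℕ<n; toℕ-inject₁; toℕ-fromℕ)
open import Data.Integer.Base using (+_; -[1+_]; _+_; _*_; 0ℤ; 1ℤ)
open import Data.Integer.Properties as ℤ using (+-*-semiring; +-*-commutativeSemiring)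
open import Data.Integer.Divisibility.Signed
open import Data.Integer.Tactic.RingSolver using (solve-∀)
open import Algebra.Properties.CommutativeSemiring.Binomial +-*-commutativeSemiring
  using (theorem; binomial; binomialTerm)
open import Algebra.Properties.Semiring.Sum +-*-semiring using (sum; sum-init-last)
open import Algebra.Properties.Semiring.Mult +-*-semiring using (_×_)
open import Algebra.Properties.Semiring.Exp +-*-semiring using () renaming (_^_ to _^ˢ_)
open import Data.Sum using ([_,_]′)
open import Data.Empty using (⊥-elim)
open import Function using (id; _∘_; mk⇔; Equivalence)
open import Function.Properties.Equivalence using () renaming (sym to ⇔-sym)
open import Relation.Binary.PropositionalEquality

n∣n! : ∀ n → .{{NonZero n}} → n ℕ.∣ n !
n∣n! (suc n) = ℕ.m∣m*n (n !)

prime∤m! : ∀ {p} → Prime p → ∀ {m} → m < p → p ℕ.∤ m !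
prime∤m! pp {zero}  _   p∣1  = ℕ.nonTrivial⇒≢1 {{prime⇒nonTrivial pp}} (ℕ.∣1⇒≡1 p∣1)
prime∤m! pp {suc m} m<p p∣m! =
  [ (λ p∣1+m → <⇒≱ m<p (ℕ.∣⇒≤ p∣1+m)) , prime∤m! pp (<-trans (n<1+n m) m<p) ]′
    (euclidsLemma (suc m) (m !) pp p∣m!)

k!*[n∸k]!*nCk≡n! : ∀ {n k} → k ≤ n → k ! ℕ.* (n ∸ k) ! ℕ.* (n C k) ≡ n !
k!*[n∸k]!*nCk≡n! {n} {k} k≤n = begin
  k ! ℕ.* (n ∸ k) ! ℕ.* (n C k)                    ≡⟨ cong (k ! ℕ.* (n ∸ k) ! ℕ.*_) (nCk≡n!/k![n-k]! k≤n) ⟩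
  k ! ℕ.* (n ∸ k) ! ℕ.* (n ! / (k ! ℕ.* (n ∸ k) !)) ≡⟨ m*[n/m]≡n (k![n∸k]!∣n! k≤n) ⟩
  n !                                              ∎
  where
  open ≡-Reasoning
  instance _ = k !* (n ∸ k) !≢0

prime∣pCk : ∀ {p k} → Prime p → 0 < k → k < p → p ℕ.∣ p C k
prime∣pCk {p} {k} pp 0<k k<p =
  [ (λ p∣k!*[p∸k]! → ⊥-elim ([ prime∤m! pp k<p , prime∤m! pp p∸k<p ]′ (euclidsLemma _ _ pp p∣k!*[p∸k]!))) , id ]′
    (euclidsLemma (k ! ℕ.* (p ∸ k) !) (p C k) pp p∣product)
  where
  instance _ = prime⇒nonZero pp
  p∸k<p : p ∸ k < p
  p∸k<p = ∸-monoʳ-< 0<k (<⇒≤ k<p)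
  p∣product : p ℕ.∣ k ! ℕ.* (p ∸ k) ! ℕ.* (p C k)
  p∣product = subst (p ℕ.∣_) (sym (k!*[n∸k]!*nCk≡n! (<⇒≤ k<p))) (n∣n! p)

∣0 : ∀ {d} → d ∣ 0ℤ
∣0 = divides 0ℤ refl

∣-sum : ∀ {d n} (f : Fin n → ℤ) → (∀ i → d ∣ f i) → d ∣ sum f
∣-sum {n = zero}  f _   = ∣0
∣-sum {n = suc n} f d∣f = ∣m∣n⇒∣m+n (d∣f zero) (∣-sum (f ∘ suc) (d∣f ∘ suc))

×≡* : ∀ n x → n × x ≡ + n * x
×≡* zero    x = refl
×≡* (suc n) x = begin
  x + n × x     ≡⟨ cong (_+_ x) (×≡* n x) ⟩
  x + + n * x   ≡⟨ ℤ.suc-* (+ n) x ⟨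
  + suc n * x   ∎
  where open ≡-Reasoning

-- The binomial theorem of the library is stated with the semiring's own
-- exponentiation, which is not definitionally that of Data.Integer.
^ˢ≡^ : ∀ x n → x ^ˢ n ≡ x ^ n
^ˢ≡^ x zero    = refl
^ˢ≡^ x (suc n) = cong (x *_) (^ˢ≡^ x n)

prime∣[x+y]^p-[x^p+y^p] : ∀ {p} → Prime p → ∀ x y → + p ∣ (x + y) ^ p - (x ^ p + y ^ p)
prime∣[x+y]^p-[x^p+y^p] {suc q} pp x y =
  subst (+ suc q ∣_) (sym expansion) (∣-sum middleTerm p∣middleTerm)
  where
  open ≡-Reasoning
  p = suc q
  term : Fin (suc p) → ℤ
  term = binomialTerm x y p
  middleTerm : Fin q → ℤ
  middleTerm i = term (suc (inject₁ i))
  p∣middleTerm : ∀ i → + p ∣ middleTerm i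
  p∣middleTerm i = subst (+ p ∣_) (sym (×≡* (p C k) (binomial x y p (suc (inject₁ i)))))
    (∣m⇒∣m*n _ (∣ᵤ⇒∣ {+ p} {+ (p C k)} (prime∣pCk pp (s≤s z≤n) k<p)))
    where
    k = suc (toℕ (inject₁ i))
    k<p : k < p
    k<p = s≤s (subst (_< q) (sym (toℕ-inject₁ i)) (toℕ<n i))
  firstTerm : term zero ≡ y ^ p
  firstTerm = begin
    1 × (1ℤ * y ^ˢ p)   ≡⟨ ×≡* 1 (1ℤ * y ^ˢ p) ⟩
    1ℤ * (1ℤ * y ^ˢ p)  ≡⟨ trans (ℤ.*-identityˡ _) (ℤ.*-identityˡ _) ⟩
    y ^ˢ p              ≡⟨ ^ˢ≡^ y p ⟩
    y ^ p               ∎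
  lastTerm : term (suc (fromℕ q)) ≡ x ^ p
  lastTerm = begin
    term (suc (fromℕ q))
      ≡⟨ ×≡* (p C toℕ (suc (fromℕ q))) (binomial x y p (suc (fromℕ q))) ⟩
    + (p C suc (toℕ (fromℕ q))) * (x ^ˢ suc (toℕ (fromℕ q)) * y ^ˢ (q ∸ toℕ (fromℕ q)))
      ≡⟨ cong (λ k → + (p C suc k) * (x ^ˢ suc k * y ^ˢ (q ∸ k))) (toℕ-fromℕ q) ⟩
    + (p C p) * (x ^ˢ p * y ^ˢ (q ∸ q))
      ≡⟨ cong₂ (λ c e → + c * (x ^ˢ p * y ^ˢ e)) (nCn≡1 p) (ℕ.n∸n≡0 q) ⟩
    1ℤ * (x ^ˢ p * 1ℤ)
      ≡⟨ trans (ℤ.*-identityˡ _) (trans (ℤ.*-identityʳ _) (^ˢ≡^ x p)) ⟩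
    x ^ p ∎
  cancel : ∀ b m a → (b + (m + a)) - (a + b) ≡ m
  cancel = solve-∀
  expansion : (x + y) ^ p - (x ^ p + y ^ p) ≡ sum middleTerm
  expansion = begin
    (x + y) ^ p - (x ^ p + y ^ p)
      ≡⟨ cong (_- (x ^ p + y ^ p)) (trans (sym (^ˢ≡^ (x + y) p)) (theorem p x y)) ⟩
    (term zero + sum (term ∘ suc)) - (x ^ p + y ^ p)
      ≡⟨ cong (λ s → (term zero + s) - (x ^ p + y ^ p)) (sum-init-last (term ∘ suc)) ⟩
    (term zero + (sum middleTerm + term (suc (fromℕ q)))) - (x ^ p + y ^ p)
      ≡⟨ cong₂ (λ b a → (b + (sum middleTerm + a)) - (x ^ p + y ^ p)) firstTerm lastTerm ⟩
    (y ^ p + (sum middleTerm + x ^ p)) - (x ^ p + y ^ p)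
      ≡⟨ cancel (y ^ p) (sum middleTerm) (x ^ p) ⟩
    sum middleTerm ∎

0^n≡0 : ∀ n → .{{NonZero n}} → 0ℤ ^ n ≡ 0ℤ
0^n≡0 (suc n) = refl

module _ {p} (pp : Prime p) where

  prime∣[1+x]^p-[1+x^p] : ∀ x → + p ∣ (1ℤ + x) ^ p - (1ℤ + x ^ p)
  prime∣[1+x]^p-[1+x^p] x =
    subst (λ z → + p ∣ (1ℤ + x) ^ p - (z + x ^ p)) (ℤ.^-zeroˡ p) (prime∣[x+y]^p-[x^p+y^p] pp 1ℤ x)

  p∣x^p-x⇔p∣[1+x]^p-[1+x] : ∀ x → + p ∣ x ^ p - x ⇔ + p ∣ (1ℤ + x) ^ p - (1ℤ + x)
  p∣x^p-x⇔p∣[1+x]^p-[1+x] x = mk⇔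
    (λ h → subst (+ p ∣_) (sym regrouped) (∣m∣n⇒∣m+n (prime∣[1+x]^p-[1+x^p] x) h))
    (λ h → ∣m+n∣m⇒∣n (subst (+ p ∣_) regrouped h) (prime∣[1+x]^p-[1+x^p] x))
    where
    regroup : ∀ u v x → u - (1ℤ + x) ≡ (u - (1ℤ + v)) + (v - x)
    regroup = solve-∀
    regrouped : (1ℤ + x) ^ p - (1ℤ + x) ≡ ((1ℤ + x) ^ p - (1ℤ + x ^ p)) + (x ^ p - x)
    regrouped = regroup ((1ℤ + x) ^ p) (x ^ p) x

  fermat : ∀ a → + p ∣ a ^ p - a
  fermat (+ zero)     = subst (λ z → + p ∣ z - 0ℤ) (sym (0^n≡0 p)) ∣0
    where instance _ = prime⇒nonZero pp
  fermat (+ suc n)    = Equivalence.to (p∣x^p-x⇔p∣[1+x]^p-[1+x] (+ n)) (fermat (+ n))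
  fermat -[1+ zero ]  = Equivalence.from (p∣x^p-x⇔p∣[1+x]^p-[1+x] -[1+ zero ]) (fermat (+ zero))
  fermat -[1+ suc n ] = Equivalence.from (p∣x^p-x⇔p∣[1+x]^p-[1+x] -[1+ suc n ]) (fermat -[1+ n ])

geometric : ℤ → ℤ → ℕ → ℤ
geometric x y zero    = 0ℤ
geometric x y (suc n) = x ^ n + y * geometric x y n

x^n-y^n≡[x-y]*geometric : ∀ x y n → x ^ n - y ^ n ≡ (x - y) * geometric x y n
x^n-y^n≡[x-y]*geometric x y zero    = sym (ℤ.*-zeroʳ (x - y))
x^n-y^n≡[x-y]*geometric x y (suc n) = begin
  x * x ^ n - y * y ^ n                     ≡⟨ regroup x y (x ^ n) (y ^ n) ⟩
  (x - y) * x ^ n + y * (x ^ n - y ^ n)     ≡⟨ cong (λ z → (x - y) * x ^ n + y * z) (x^n-y^n≡[x-y]*geometric x y n) ⟩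
  (x - y) * x ^ n + y * ((x - y) * geometric x y n) ≡⟨ factor x y (x ^ n) (geometric x y n) ⟩
  (x - y) * geometric x y (suc n)           ∎
  where
  open ≡-Reasoning
  regroup : ∀ x y u v → x * u - y * v ≡ (x - y) * u + y * (u - v)
  regroup = solve-∀
  factor : ∀ x y u g → (x - y) * u + y * ((x - y) * g) ≡ (x - y) * (u + y * g)
  factor = solve-∀

x-y∣x^n-y^n : ∀ x y n → x - y ∣ x ^ n - y ^ n
x-y∣x^n-y^n x y n = divides (geometric x y n) (trans (x^n-y^n≡[x-y]*geometric x y n) (ℤ.*-comm (x - y) (geometric x y n)))

∣x-y⇒∣geometric-n*y^[n-1] : ∀ {d x y} → d ∣ x - y → ∀ n → d ∣ geometric x y (suc n) - + suc n * y ^ n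
∣x-y⇒∣geometric-n*y^[n-1] {d} {x} {y} d∣x-y zero = subst (d ∣_) (sym (vanish y)) ∣0
  where
  vanish : ∀ y → (1ℤ + y * 0ℤ) - 1ℤ * 1ℤ ≡ 0ℤ
  vanish = solve-∀
∣x-y⇒∣geometric-n*y^[n-1] {d} {x} {y} d∣x-y (suc n) =
  subst (d ∣_) (sym (regroup x y (x ^ n) (y ^ n) (geometric x y (suc n)) (+ suc n)))
    (∣m∣n⇒∣m+n (∣-trans d∣x-y (x-y∣x^n-y^n x y (suc n))) (∣n⇒∣m*n y (∣x-y⇒∣geometric-n*y^[n-1] d∣x-y n)))
  where
  regroup : ∀ x y u v g m → (x * u + y * g) - (1ℤ + m) * (y * v) ≡ (x * u - y * v) + y * (g - m * v)
  regroup = solve-∀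

n∣x-y⇒d*n∣x^n-y^n : ∀ n {d x y} → + n ∣ x - y → d ∣ x - y → d * + n ∣ x ^ n - y ^ n
n∣x-y⇒d*n∣x^n-y^n zero    _ _ = divides 0ℤ refl
n∣x-y⇒d*n∣x^n-y^n (suc n) {d} {x} {y} n∣x-y d∣x-y =
  subst (d * + suc n ∣_) (sym (x^n-y^n≡[x-y]*geometric x y (suc n)))
    (∣-trans (*-monoʳ-∣ d n∣geometric) (*-monoˡ-∣ (geometric x y (suc n)) d∣x-y))
  where
  n∣geometric : + suc n ∣ geometric x y (suc n)
  n∣geometric = ∣m+n∣n⇒∣m (∣x-y⇒∣geometric-n*y^[n-1] n∣x-y n) (∣m⇒∣-m (∣m⇒∣m*n (y ^ n) ∣-refl))

∣x^n-x⇒∣x^[n^j]-x : ∀ {d} x n → d ∣ x ^ n - x → ∀ j → d ∣ x ^ (n ℕ.^ j) - x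
∣x^n-x⇒∣x^[n^j]-x {d} x n d∣x^n-x zero =
  subst (d ∣_) (sym (trans (cong (_- x) (ℤ.^-identityʳ x)) (ℤ.+-inverseʳ x))) ∣0
∣x^n-x⇒∣x^[n^j]-x {d} x n d∣x^n-x (suc j) = subst (d ∣_) (sym telescope)
  (∣m∣n⇒∣m+n (∣-trans (∣x^n-x⇒∣x^[n^j]-x x n d∣x^n-x j) (x-y∣x^n-y^n (x ^ (n ℕ.^ j)) x n)) d∣x^n-x)
  where
  open ≡-Reasoning
  split : ∀ u v x → u - x ≡ (u - v) + (v - x)
  split = solve-∀
  telescope : x ^ (n ℕ.^ suc j) - x ≡ ((x ^ (n ℕ.^ j)) ^ n - x ^ n) + (x ^ n - x)
  telescope = begin
    x ^ (n ℕ.* n ℕ.^ j) - x       ≡⟨ cong (λ e → x ^ e - x) (ℕ.*-comm n (n ℕ.^ j)) ⟩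
    x ^ (n ℕ.^ j ℕ.* n) - x       ≡⟨ cong (_- x) (ℤ.^-*-assoc x (n ℕ.^ j) n) ⟨
    (x ^ (n ℕ.^ j)) ^ n - x       ≡⟨ split ((x ^ (n ℕ.^ j)) ^ n) (x ^ n) x ⟩
    ((x ^ (n ℕ.^ j)) ^ n - x ^ n) + (x ^ n - x) ∎

q^k∣x⇔q^k∣y : ∀ {q x y} → (∀ k → + (q ℕ.^ k) ∣ x → + (q ℕ.^ suc k) ∣ y - x) →
            ∀ k → + (q ℕ.^ k) ∣ x ⇔ + (q ℕ.^ k) ∣ y
q^k∣x⇔q^k∣y {q} {x} {y} gap k = mk⇔ (forward k) (backward k)
  where
  qᵏ∣qᵏ⁺¹ : ∀ k → + (q ℕ.^ k) ∣ + (q ℕ.^ suc k)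
  qᵏ∣qᵏ⁺¹ k = divides (+ q) (ℤ.pos-* q (q ℕ.^ k))
  y≡[y-x]+x : ∀ x y → y ≡ (y - x) + x
  y≡[y-x]+x = solve-∀
  x≡y-[y-x] : ∀ x y → x ≡ y - (y - x)
  x≡y-[y-x] = solve-∀
  forward : ∀ k → + (q ℕ.^ k) ∣ x → + (q ℕ.^ k) ∣ y
  forward k qᵏ∣x = subst (_ ∣_) (sym (y≡[y-x]+x x y)) (∣m∣n⇒∣m+n (∣-trans (qᵏ∣qᵏ⁺¹ k) (gap k qᵏ∣x)) qᵏ∣x)
  backward : ∀ k → + (q ℕ.^ k) ∣ y → + (q ℕ.^ k) ∣ x
  backward zero    _      = divides x (sym (ℤ.*-identityʳ x))
  backward (suc k) qᵏ⁺¹∣y = subst (_ ∣_) (sym (x≡y-[y-x] x y))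
    (∣m∣n⇒∣m-n qᵏ⁺¹∣y (gap k (backward k (∣-trans (qᵏ∣qᵏ⁺¹ k) qᵏ⁺¹∣y))))

n<m^n : ∀ {m} → 1 < m → ∀ n → n < m ℕ.^ n
n<m^n 1<m zero = s≤s z≤n
n<m^n {m} 1<m (suc n) = begin-strict
  suc n            ≤⟨ n<m^n 1<m n ⟩
  m ℕ.^ n          <⟨ m<m*n (m ℕ.^ n) m 1<m ⟩
  m ℕ.^ n ℕ.* m    ≡⟨ ℕ.*-comm (m ℕ.^ n) m ⟩
  m ℕ.^ suc n      ∎
  where
  open ℕ.≤-Reasoning
  instance _ = m^n≢0 m n {{ℕ.>-nonZero (<-trans (s≤s z≤n) 1<m)}}

∀q^k∣x⇒x≡0 : ∀ {q x} → 1 < q → (∀ k → + (q ℕ.^ k) ∣ x) → x ≡ 0ℤ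
∀q^k∣x⇒x≡0 {q} {x} 1<q qᵏ∣x with Data.Integer.Base.∣ x ∣ in ∣x∣≡
... | zero  = ℤ.∣i∣≡0⇒i≡0 ∣x∣≡
... | suc n = ⊥-elim (<⇒≱ (n<m^n 1<q (suc n)) (ℕ.∣⇒≤ (subst (q ℕ.^ suc n ℕ.∣_) ∣x∣≡ (∣⇒∣ᵤ (qᵏ∣x (suc n))))))

Val-transfer : ∀ {p x y v} → 1 < p → (∀ k → + (p ℕ.^ k) ∣ x ⇔ + (p ℕ.^ k) ∣ y) → Val p x v → Val p y v
Val-transfer 1<p x≈y (val-∞ refl) = val-∞ (∀q^k∣x⇒x≡0 1<p (λ k → Equivalence.to (x≈y k) ∣0))
Val-transfer 1<p x≈y (val-fin k x≢0 pᵏ∣x pᵏ⁺¹∤x) = val-fin k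
  (λ { refl → x≢0 (∀q^k∣x⇒x≡0 1<p (λ j → Equivalence.from (x≈y j) ∣0)) })
  (∣⇒∣ᵤ (Equivalence.to (x≈y k) (∣ᵤ⇒∣ pᵏ∣x)))
  (pᵏ⁺¹∤x ∘ ∣⇒∣ᵤ ∘ Equivalence.from (x≈y (suc k)) ∘ ∣ᵤ⇒∣)

Val-cong : ∀ {p x y} → 1 < p → (∀ k → + (p ℕ.^ k) ∣ x ⇔ + (p ℕ.^ k) ∣ y) → ∀ v → Val p x v ⇔ Val p y v
Val-cong 1<p x≈y v = mk⇔ (Val-transfer 1<p x≈y) (Val-transfer 1<p (⇔-sym ∘ x≈y))

p^k∣a^p-a⇒p^[k+1]∣a^[p^m]-a^p : ∀ {p} → Prime p → ∀ a k → + (p ℕ.^ k) ∣ a ^ p - a →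
                             ∀ m → + (p ℕ.^ suc k) ∣ a ^ (p ℕ.^ suc m) - a ^ p
p^k∣a^p-a⇒p^[k+1]∣a^[p^m]-a^p {p} pp a k pᵏ∣a^p-a m =
  subst (λ b → + (p ℕ.^ suc k) ∣ b - a ^ p) (ℤ.^-*-assoc a p (p ℕ.^ m))
    (∣x^n-x⇒∣x^[n^j]-x (a ^ p) p pᵏ⁺¹∣a^p^p-a^p m)
  where
  pᵏ*p≡pᵏ⁺¹ : + (p ℕ.^ k) * + p ≡ + (p ℕ.^ suc k)
  pᵏ*p≡pᵏ⁺¹ = trans (sym (ℤ.pos-* (p ℕ.^ k) p)) (cong +_ (ℕ.*-comm (p ℕ.^ k) p))
  pᵏ⁺¹∣a^p^p-a^p : + (p ℕ.^ suc k) ∣ (a ^ p) ^ p - a ^ p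
  pᵏ⁺¹∣a^p^p-a^p = subst (_∣ (a ^ p) ^ p - a ^ p) pᵏ*p≡pᵏ⁺¹ (n∣x-y⇒d*n∣x^n-y^n p (fermat pp a) pᵏ∣a^p-a)

lemma3p2 : (p : ℕ) → Prime p → (a : ℤ) → (m : ℕ) → 0 < m →
    (v : ℕ∞) → Val p (a ^ p - a) v ⇔ Val p (a ^ (p Data.Nat.^ m) - a) v
lemma3p2 p pp a (suc m) _ = Val-cong (ℕ.nonTrivial⇒n>1 p {{prime⇒nonTrivial pp}}) (q^k∣x⇔q^k∣y gap)
  where
  regroup : ∀ u v a → u - v ≡ (u - a) - (v - a)
  regroup = solve-∀
  gap : ∀ k → + (p ℕ.^ k) ∣ a ^ p - a → + (p ℕ.^ suc k) ∣ (a ^ (p ℕ.^ suc m) - a) - (a ^ p - a)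
  gap k h = subst (_ ∣_) (regroup (a ^ (p ℕ.^ suc m)) (a ^ p) a) (p^k∣a^p-a⇒p^[k+1]∣a^[p^m]-a^p pp a k h m)
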